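{- For every integer $d\ge 2$ there is a constant $C_d$ with $1\le C_d\le \chi_2(d)-1$, depending only on $d$, such that for all integers $n\ge d$, \[ \chi_2(n) \le \left\lfloor \frac{\chi_2(d)-1}{d-1}\, n \right\rfloor + C_d . \] Moreover, one can take $C_4=1$.
   Context: $\chi_2(m)$ denotes the minimum number of colors needed to color the nonzero vectors of $\mathbb{F}_2^m$ (the points of $\mathrm{PG}(m-1,2)$) so that no triple $\{x,y,x+y\}$ with $x\ne y$ nonzero (a line of $\mathrm{PG}(m-1,2)$) is monochromatic. -}

module Defs where

open import Data.Bool using (Bool; true; false; _xor_)
open import Data.Nat using (ℕ; zero; suc; _≤_)
open import Data.Nat.DivMod using (_/_)
open import Data.Fin using (Fin)
open import Data.Vec using (Vec; replicate; zipWith)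
open import Data.Product using (Σ; _×_)
open import Relation.Binary.PropositionalEquality using (_≡_; _≢_)
open import Relation.Nullary using (¬_)

F2 : ℕ → Set
F2 m = Vec Bool m

zeroV : (m : ℕ) → F2 m
zeroV m = replicate m false

_⊕_ : {m : ℕ} → F2 m → F2 m → F2 m
_⊕_ = zipWith _xor_

-- A k-coloring of the nonzero vectors of F_2^m (values on the zero vector are
-- irrelevant) such that no line {x, y, x+y} (x ≠ y, both nonzero) is monochromatic.
ProperColoring : (m k : ℕ) → (F2 m → Fin k) → Set
ProperColoring m k c =
  (x y : F2 m) → x ≢ zeroV m → y ≢ zeroV m → x ≢ y →
  ¬ (c x ≡ c y × c y ≡ c (x ⊕ y))

Colorable : ℕ → ℕ → Set
Colorable m k = Σ (F2 m → Fin k) (ProperColoring m k)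

IsChi2 : ℕ → ℕ → Set
IsChi2 m k = Colorable m k × ((j : ℕ) → Colorable m j → k ≤ j)

-- floor(a / b) for b ≥ 1 (value at b = 0 is irrelevant, set to 0).
floorDiv : ℕ → ℕ → ℕ
floorDiv a zero = 0
floorDiv a (suc b) = a / suc b

-- Write e = d − 1 and s = χ₂(d) − 1.  A proper (s+1)-colouring of F₂^d and a
-- proper A-colouring of F₂^(m+1) amalgamate into a proper (s+A)-colouring of
-- F₂^(d+m): e more dimensions cost at most s more colours.  Writing
-- n = q e + (r + 1) with r < e, iteration from a colouring of F₂^(r+1) gives
-- χ₂(n) ≤ q s + χ₂(r+1).  For the base use χ₂(r+1) ≤ r + 1 when r < s, and
-- otherwise χ₂(r+1) ≤ χ₂(d); the latter stays within ⌊s(r+1)/e⌋ + s because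
-- Ramsey's theorem for triangles, applied to the edge colouring c(x ⊕ y) of
-- the complete graph on F₂^d, forces e ≤ s(s+1).  For d = 4 the same bound
-- gives χ₂(4) ≥ 3, and then χ₂(r+1) ≤ r + 1 suffices with C = 1.
module Submission where

open import Defs
open import Data.Nat
  using (ℕ; zero; suc; _≤_; _<_; _+_; _*_; _∸_; _^_; _/_; _%_; z≤n; s≤s; NonZero)
open import Data.Product using (Σ; _×_; _,_)

open import Data.Bool using (Bool; true; false; _xor_; _∨_)
open import Data.Bool.Properties
  using (xor-assoc; xor-comm; xor-identityˡ; xor-identityʳ; xor-same)
open import Data.Empty using (⊥; ⊥-elim)
open import Data.Fin using (Fin; zero; suc; inject≤; join; splitAt)
import Data.Fin.Properties as Finₚ
open import Data.List as List using (List; []; _∷_; length; filter; allFin)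
open import Data.List.Properties using (length-++; length-map; length-tabulate; filter-notAll)
open import Data.List.Membership.Propositional using (_∈_)
open import Data.List.Membership.Propositional.Properties
  using (∈-allFin; ∈-map⁻; ∈-filter⁺)
open import Data.List.Relation.Binary.Disjoint.Propositional using (Disjoint)
open import Data.List.Relation.Binary.Sublist.Propositional
  using (_⊆_; []; _∷_; _∷ʳ_; ⊆-trans)
open import Data.List.Relation.Binary.Sublist.Propositional.Properties
  using (All-resp-⊆; filter-⊆)
open import Data.List.Relation.Unary.All as All using (All; []; _∷_)
open import Data.List.Relation.Unary.All.Properties using (all-filter; filter⁺)
open import Data.List.Relation.Unary.AllPairs as AllPairs using (AllPairs; []; _∷_)
open import Data.List.Relation.Unary.Any as Any using (here; there)
open import Data.List.Relation.Unary.Unique.Propositional using (Unique)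
import Data.List.Relation.Unary.Unique.Propositional.Properties as Unique
open import Data.Nat.Properties
open import Data.Nat.DivMod
  using (m≡m%n+[m/n]*n; m%n<n; m*n/n≡m; n/n≡1; /-monoˡ-≤; +-distrib-/-∣ˡ)
open import Data.Nat.Divisibility using (n∣m*n)
open import Data.Nat.Tactic.RingSolver using (solve-∀)
open import Data.Sum using (_⊎_; inj₁; inj₂)
open import Data.Sum.Properties using (inj₁-injective; inj₂-injective)
open import Data.Vec using ([]; _∷_; take; drop; _++_)
open import Data.Vec.Properties
  using (zipWith-comm; zipWith-assoc; zipWith-identityˡ; zipWith-identityʳ; zipWith-++;
         take-zipWith; drop-zipWith; take++drop≡id; ++-injectiveˡ;
         ∷-injectiveˡ; ∷-injectiveʳ)
open import Function using (_∘_)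
open import Function.Definitions using (Injective)
open import Relation.Binary.Definitions using (DecidableEquality)
open import Relation.Binary.PropositionalEquality
open import Relation.Nullary using (¬_; ¬?; yes; no)
open import Relation.Unary using (Decidable)
open import Relation.Unary.Properties using (∁?)

⊕-comm : ∀ {n} (x y : F2 n) → x ⊕ y ≡ y ⊕ x
⊕-comm = zipWith-comm xor-comm

⊕-assoc : ∀ {n} (x y z : F2 n) → (x ⊕ y) ⊕ z ≡ x ⊕ (y ⊕ z)
⊕-assoc = zipWith-assoc xor-assoc

⊕-identityˡ : ∀ {n} (x : F2 n) → zeroV n ⊕ x ≡ x
⊕-identityˡ = zipWith-identityˡ xor-identityˡ

⊕-identityʳ : ∀ {n} (x : F2 n) → x ⊕ zeroV n ≡ x
⊕-identityʳ = zipWith-identityʳ xor-identityʳ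

⊕-self : ∀ {n} (x : F2 n) → x ⊕ x ≡ zeroV n
⊕-self []      = refl
⊕-self (b ∷ x) = cong₂ _∷_ (xor-same b) (⊕-self x)

⊕≡0⇒≡ : ∀ {n} {x y : F2 n} → x ⊕ y ≡ zeroV n → x ≡ y
⊕≡0⇒≡ {n} {x} {y} x⊕y≡0 = begin
  x                ≡⟨ ⊕-identityʳ x ⟨
  x ⊕ zeroV n      ≡⟨ cong (x ⊕_) (⊕-self y) ⟨
  x ⊕ (y ⊕ y)      ≡⟨ ⊕-assoc x y y ⟨
  (x ⊕ y) ⊕ y      ≡⟨ cong (_⊕ y) x⊕y≡0 ⟩
  zeroV n ⊕ y      ≡⟨ ⊕-identityˡ y ⟩
  y                ∎
  where open ≡-Reasoning

[x⊕y]⊕[x⊕z]≡y⊕z : ∀ {n} (x y z : F2 n) → (x ⊕ y) ⊕ (x ⊕ z) ≡ y ⊕ z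
[x⊕y]⊕[x⊕z]≡y⊕z {n} x y z = begin
  (x ⊕ y) ⊕ (x ⊕ z)  ≡⟨ cong (_⊕ (x ⊕ z)) (⊕-comm x y) ⟩
  (y ⊕ x) ⊕ (x ⊕ z)  ≡⟨ ⊕-assoc y x (x ⊕ z) ⟩
  y ⊕ (x ⊕ (x ⊕ z))  ≡⟨ cong (y ⊕_) (⊕-assoc x x z) ⟨
  y ⊕ ((x ⊕ x) ⊕ z)  ≡⟨ cong (λ v → y ⊕ (v ⊕ z)) (⊕-self x) ⟩
  y ⊕ (zeroV n ⊕ z)  ≡⟨ cong (y ⊕_) (⊕-identityˡ z) ⟩
  y ⊕ z              ∎
  where open ≡-Reasoning

zeroV-++ : ∀ m n → zeroV m ++ zeroV n ≡ zeroV (m + n)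
zeroV-++ zero    n = refl
zeroV-++ (suc m) n = cong (false ∷_) (zeroV-++ m n)

nonzero : ∀ {n} → F2 n → Bool
nonzero []      = false
nonzero (b ∷ x) = b ∨ nonzero x

nonzero-zeroV : ∀ n → nonzero (zeroV n) ≡ false
nonzero-zeroV zero    = refl
nonzero-zeroV (suc n) = nonzero-zeroV n

nonzero≡false⇒≡0 : ∀ {n} (x : F2 n) → nonzero x ≡ false → x ≡ zeroV n
nonzero≡false⇒≡0 []          _  = refl
nonzero≡false⇒≡0 (false ∷ x) eq = cong (false ∷_) (nonzero≡false⇒≡0 x eq)

nonzero≡true⇒≢0 : ∀ {n} {x : F2 n} → nonzero x ≡ true → x ≢ zeroV n
nonzero≡true⇒≢0 {n} eq refl with () ← trans (sym (nonzero-zeroV n)) eq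

-- Properness with the colour κ of a monochromatic line made explicit, so that
-- proofs can split on it.
Proper : ∀ {m} {C : Set} → (F2 m → C) → Set
Proper {m} c = ∀ {x y} κ → x ≢ zeroV m → y ≢ zeroV m → x ⊕ y ≢ zeroV m →
  c x ≡ κ → c y ≡ κ → c (x ⊕ y) ≡ κ → ⊥

properColoring⇒proper : ∀ {m k c} → ProperColoring m k c → Proper c
properColoring⇒proper pc κ x≢0 y≢0 x⊕y≢0 cx cy cx⊕y =
  pc _ _ x≢0 y≢0 (λ { refl → x⊕y≢0 (⊕-self _) })
    (trans cx (sym cy) , trans cy (sym cx⊕y))

proper⇒properColoring : ∀ {m k c} → Proper c → ProperColoring m k c
proper⇒properColoring p x y x≢0 y≢0 x≢y (cx≡cy , cy≡cx⊕y) =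
  p _ x≢0 y≢0 (x≢y ∘ ⊕≡0⇒≡) refl (sym cx≡cy) (sym (trans cx≡cy cy≡cx⊕y))

proper-∘ : ∀ {m} {C D : Set} {c : F2 m → C} (f : C → D) →
  Injective _≡_ _≡_ f → Proper c → Proper (f ∘ c)
proper-∘ f f-injective p κ x≢0 y≢0 x⊕y≢0 fcx fcy fcx⊕y =
  p _ x≢0 y≢0 x⊕y≢0 refl (f-injective (trans fcy (sym fcx)))
    (f-injective (trans fcx⊕y (sym fcx)))

proper-pullback : ∀ {m n} {C : Set} {c : F2 m → C} (f : F2 n → F2 m) →
  (∀ x y → f (x ⊕ y) ≡ f x ⊕ f y) → (∀ {x} → f x ≡ zeroV m → x ≡ zeroV n) →
  Proper c → Proper (c ∘ f)
proper-pullback {c = c} f f-⊕ f-kernel p κ x≢0 y≢0 x⊕y≢0 cx cy cx⊕y =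
  p κ (x≢0 ∘ f-kernel) (y≢0 ∘ f-kernel) (x⊕y≢0 ∘ f-kernel ∘ trans (f-⊕ _ _))
    cx cy (trans (cong c (sym (f-⊕ _ _))) cx⊕y)

colorable-monoʳ : ∀ {m a b} → a ≤ b → Colorable m a → Colorable m b
colorable-monoʳ a≤b (c , c-proper) =
  (λ x → inject≤ (c x) a≤b) ,
  proper⇒properColoring
    (proper-∘ (λ i → inject≤ i a≤b) (Finₚ.inject≤-injective a≤b a≤b _ _)
              (properColoring⇒proper c-proper))

pad : ∀ {m} t → F2 m → F2 (m + t)
pad t x = x ++ zeroV t

pad-⊕ : ∀ {m} t (x y : F2 m) → pad t (x ⊕ y) ≡ pad t x ⊕ pad t y
pad-⊕ t x y = begin
  (x ⊕ y) ++ zeroV t                ≡⟨ cong ((x ⊕ y) ++_) (⊕-self (zeroV t)) ⟨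
  (x ⊕ y) ++ (zeroV t ⊕ zeroV t)    ≡⟨ zipWith-++ _xor_ x (zeroV t) y (zeroV t) ⟨
  pad t x ⊕ pad t y                 ∎
  where open ≡-Reasoning

pad≡0⇒≡0 : ∀ {m} t {x : F2 m} → pad t x ≡ zeroV (m + t) → x ≡ zeroV m
pad≡0⇒≡0 {m} t {x} eq = ++-injectiveˡ x (zeroV m) (trans eq (sym (zeroV-++ m t)))

colorable-restrict : ∀ {m n k} → m ≤ n → Colorable n k → Colorable m k
colorable-restrict m≤n (c , c-proper) with t , refl ← m≤n⇒∃[o]m+o≡n m≤n =
  c ∘ pad t ,
  proper⇒properColoring
    (proper-pullback (pad t) (pad-⊕ t) (pad≡0⇒≡0 t) (properColoring⇒proper c-proper))

colorable-1-1 : Colorable 1 1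
colorable-1-1 = (λ _ → zero) , proper
  where
  proper : ProperColoring 1 1 (λ _ → zero)
  proper (false ∷ []) _            x≢0 _   _   _ = x≢0 refl
  proper (true ∷ [])  (false ∷ []) _   y≢0 _   _ = y≢0 refl
  proper (true ∷ [])  (true ∷ [])  _   _   x≢y _ = x≢y refl

colorable-2-2 : Colorable 2 2
colorable-2-2 = lastBit , proper
  where
  lastBit : F2 2 → Fin 2
  lastBit (_ ∷ false ∷ []) = zero
  lastBit (_ ∷ true ∷ [])  = suc zero

  proper : ProperColoring 2 2 lastBit
  proper (_ ∷ true ∷ [])      (_ ∷ true ∷ [])      _   _   _   (_ , ())
  proper (_ ∷ true ∷ [])      (_ ∷ false ∷ [])     _   _   _   (() , _)
  proper (_ ∷ false ∷ [])     (_ ∷ true ∷ [])      _   _   _   (() , _)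
  proper (false ∷ false ∷ []) _                    x≢0 _   _   _ = x≢0 refl
  proper (true ∷ false ∷ [])  (false ∷ false ∷ []) _   y≢0 _   _ = y≢0 refl
  proper (true ∷ false ∷ [])  (true ∷ false ∷ [])  _   _   x≢y _ = x≢y refl

-- A point x of F₂^(d+m) lies over u = take d x.  If u ≠ 0 and cd u ≠ 0 it keeps
-- the colour cd u; otherwise u lies in S = {0} ∪ cd⁻¹(0) and x is coloured by
-- ch ∘ lift.  The three values of u on a line over S cannot all be nonzero, so
-- they are 0, 0, 0 or 0, u, u in some order, and lift is additive on such lines.
module Amalgamation {d m s A : ℕ}
  (cd : F2 d → Fin (suc s)) (cd-proper : Proper cd)
  (ch : F2 (suc m) → Fin A) (ch-proper : Proper ch) where

  open ≡-Reasoning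

  InS : F2 d → Set
  InS u = nonzero u ≡ true → cd u ≡ zero

  lift : F2 (d + m) → F2 (suc m)
  lift x = nonzero (take d x) ∷ drop d x

  paint : Bool → Fin (suc s) → F2 m → Fin s ⊎ Fin A
  paint true (suc j) w = inj₁ j
  paint b    _       w = inj₂ (ch (b ∷ w))

  colour : F2 (d + m) → Fin s ⊎ Fin A
  colour x = paint (nonzero (take d x)) (cd (take d x)) (drop d x)

  take-⊕ : ∀ (x y : F2 (d + m)) → take d (x ⊕ y) ≡ take d x ⊕ take d y
  take-⊕ x y = take-zipWith _xor_ x y

  colour≡inj₁ : ∀ x {j} → colour x ≡ inj₁ j →
    take d x ≢ zeroV d × cd (take d x) ≡ suc j
  colour≡inj₁ x eq with nonzero (take d x) in nz | cd (take d x)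
  ... | true | suc _ = nonzero≡true⇒≢0 nz , cong suc (inj₁-injective eq)

  colour≡inj₂ : ∀ x {i} → colour x ≡ inj₂ i → InS (take d x) × ch (lift x) ≡ i
  colour≡inj₂ x eq with nonzero (take d x) | cd (take d x)
  ... | true  | zero = (λ _ → refl) , inj₂-injective eq
  ... | false | _    = (λ ()) , inj₂-injective eq

  nonzero-⊕ : ∀ u v → InS u → InS v → InS (u ⊕ v) →
    nonzero (u ⊕ v) ≡ nonzero u xor nonzero v
  nonzero-⊕ u v inS-u inS-v inS-u⊕v
    with nonzero u in nu | nonzero v in nv | nonzero (u ⊕ v) in nu⊕v
  ... | false | b | b′ = begin
    b′                     ≡⟨ nu⊕v ⟨
    nonzero (u ⊕ v)        ≡⟨ cong (nonzero ∘ (_⊕ v)) (nonzero≡false⇒≡0 u nu) ⟩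
    nonzero (zeroV d ⊕ v)  ≡⟨ cong nonzero (⊕-identityˡ v) ⟩
    nonzero v              ≡⟨ nv ⟩
    b                      ∎
  ... | true  | false | b′ = begin
    b′                     ≡⟨ nu⊕v ⟨
    nonzero (u ⊕ v)        ≡⟨ cong (nonzero ∘ (u ⊕_)) (nonzero≡false⇒≡0 v nv) ⟩
    nonzero (u ⊕ zeroV d)  ≡⟨ cong nonzero (⊕-identityʳ u) ⟩
    nonzero u              ≡⟨ nu ⟩
    true                   ∎
  ... | true  | true  | false = refl
  ... | true  | true  | true  =
    ⊥-elim (cd-proper zero
             (nonzero≡true⇒≢0 nu) (nonzero≡true⇒≢0 nv) (nonzero≡true⇒≢0 nu⊕v)
             (inS-u refl) (inS-v refl) (inS-u⊕v refl))

  lift-⊕ : ∀ x y → InS (take d x) → InS (take d y) → InS (take d (x ⊕ y)) →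
    lift (x ⊕ y) ≡ lift x ⊕ lift y
  lift-⊕ x y inS-x inS-y inS-x⊕y = cong₂ _∷_
    (trans (cong nonzero (take-⊕ x y))
           (nonzero-⊕ _ _ inS-x inS-y (subst InS (take-⊕ x y) inS-x⊕y)))
    (drop-zipWith _xor_ x y)

  lift≡0⇒≡0 : ∀ x → lift x ≡ zeroV (suc m) → x ≡ zeroV (d + m)
  lift≡0⇒≡0 x eq = begin
    x                     ≡⟨ take++drop≡id d x ⟨
    take d x ++ drop d x  ≡⟨ cong₂ _++_ (nonzero≡false⇒≡0 _ (∷-injectiveˡ eq))
                                        (∷-injectiveʳ eq) ⟩
    zeroV d ++ zeroV m    ≡⟨ zeroV-++ d m ⟩
    zeroV (d + m)         ∎

  colour-proper : Proper colour
  colour-proper {x} {y} (inj₁ j) _ _ _ cx cy cx⊕y =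
    let u≢0 , cd-u = colour≡inj₁ x cx
        v≢0 , cd-v = colour≡inj₁ y cy
        u⊕v≢0 , cd-u⊕v = subst (λ w → w ≢ zeroV d × cd w ≡ suc j) (take-⊕ x y)
                               (colour≡inj₁ (x ⊕ y) cx⊕y)
    in cd-proper (suc j) u≢0 v≢0 u⊕v≢0 cd-u cd-v cd-u⊕v
  colour-proper {x} {y} (inj₂ i) x≢0 y≢0 x⊕y≢0 cx cy cx⊕y =
    let inS-x , ch-x = colour≡inj₂ x cx
        inS-y , ch-y = colour≡inj₂ y cy
        inS-x⊕y , ch-x⊕y = colour≡inj₂ (x ⊕ y) cx⊕y
        additive = lift-⊕ x y inS-x inS-y inS-x⊕y
    in ch-proper i (x≢0 ∘ lift≡0⇒≡0 x) (y≢0 ∘ lift≡0⇒≡0 y)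
         (x⊕y≢0 ∘ lift≡0⇒≡0 (x ⊕ y) ∘ trans additive) ch-x ch-y
         (subst (λ v → ch v ≡ i) additive ch-x⊕y)

amalgamate : ∀ {d m s A} → Colorable d (suc s) → Colorable (suc m) A →
  Colorable (d + m) (s + A)
amalgamate {s = s} {A} (cd , cd-proper) (ch , ch-proper) =
  join s A ∘ colour ,
  proper⇒properColoring (proper-∘ (join s A) join-injective colour-proper)
  where
  open Amalgamation cd (properColoring⇒proper cd-proper) ch (properColoring⇒proper ch-proper)
  join-injective : Injective _≡_ _≡_ (join s A)
  join-injective {a} {b} eq = begin
    a                     ≡⟨ Finₚ.splitAt-join s A a ⟨
    splitAt s (join s A a) ≡⟨ cong (splitAt s) eq ⟩
    splitAt s (join s A b) ≡⟨ Finₚ.splitAt-join s A b ⟩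
    b                     ∎
    where open ≡-Reasoning

colorable-diagonal : ∀ r → Colorable (suc r) (suc r)
colorable-diagonal zero    = colorable-1-1
colorable-diagonal (suc r) = amalgamate colorable-2-2 (colorable-diagonal r)

colorable-iterate : ∀ {e s r a} → Colorable (suc e) (suc s) → Colorable (suc r) a →
  ∀ q → Colorable (suc (q * e + r)) (q * s + a)
colorable-iterate col base zero = base
colorable-iterate {e} {s} {r} {a} col base (suc q) =
  subst₂ Colorable (cong suc (sym (+-assoc e (q * e) r))) (sym (+-assoc s (q * s) a))
    (amalgamate col (colorable-iterate col base q))

s*[1+qe+r]/e≡qs+s*[1+r]/e : ∀ s q r e .{{_ : NonZero e}} →
  s * suc (q * e + r) / e ≡ q * s + s * suc r / e
s*[1+qe+r]/e≡qs+s*[1+r]/e s q r e = begin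
  s * suc (q * e + r) / e          ≡⟨ cong (_/ e) (expand s q r e) ⟩
  (q * s * e + s * suc r) / e      ≡⟨ +-distrib-/-∣ˡ (s * suc r) (n∣m*n (q * s)) ⟩
  q * s * e / e + s * suc r / e    ≡⟨ cong (_+ s * suc r / e) (m*n/n≡m (q * s) e) ⟩
  q * s + s * suc r / e            ∎
  where
  open ≡-Reasoning
  expand : ∀ s q r e → s * suc (q * e + r) ≡ q * s * e + s * suc r
  expand = solve-∀

colorable-linear : ∀ {e s C} .{{_ : NonZero e}} → Colorable (suc e) (suc s) →
  (∀ r → r < e → Colorable (suc r) (s * suc r / e + C)) →
  ∀ n → Colorable (suc n) (s * suc n / e + C)
colorable-linear {e} {s} {C} col base n =
  subst (λ k → Colorable (suc k) (s * suc k / e + C)) qe+r≡n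
    (subst (Colorable _) colours (colorable-iterate col (base r (m%n<n n e)) q))
  where
  q = n / e
  r = n % e
  qe+r≡n : q * e + r ≡ n
  qe+r≡n = trans (+-comm (q * e) r) (sym (m≡m%n+[m/n]*n n e))
  colours : q * s + (s * suc r / e + C) ≡ s * suc (q * e + r) / e + C
  colours = trans (sym (+-assoc (q * s) _ C))
                  (cong (_+ C) (sym (s*[1+qe+r]/e≡qs+s*[1+r]/e s q r e)))

-- ramseyBound t = t! · Σ_{i ≤ t} 1/i!, the classical bound for R(3; t) − 1.
ramseyBound : ℕ → ℕ
ramseyBound zero    = 1
ramseyBound (suc t) = suc (suc t * ramseyBound t)

AllPairs-resp-⊆ : ∀ {V : Set} {R : V → V → Set} {xs ys} →
  xs ⊆ ys → AllPairs R ys → AllPairs R xs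
AllPairs-resp-⊆ []          []         = []
AllPairs-resp-⊆ (_ ∷ʳ ⊆ys)  (_ ∷ pys)  = AllPairs-resp-⊆ ⊆ys pys
AllPairs-resp-⊆ (refl ∷ ⊆ys) (py ∷ pys) = All-resp-⊆ ⊆ys py ∷ AllPairs-resp-⊆ ⊆ys pys

length-filter-∁ : ∀ {V : Set} {P : V → Set} (P? : Decidable P) xs →
  length xs ≡ length (filter P? xs) + length (filter (∁? P?) xs)
length-filter-∁ P? []       = refl
length-filter-∁ P? (x ∷ xs) with P? x
... | yes _ = cong suc (length-filter-∁ P? xs)
... | no  _ = trans (cong suc (length-filter-∁ P? xs)) (sym (+-suc _ _))

module _ {V C : Set} (_≟_ : DecidableEquality C) (f : V → C) where

  pigeonhole : ∀ {n} L ys → All (λ y → f y ∈ L) ys →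
    (∀ {c G} → c ∈ L → G ⊆ ys → All (λ y → f y ≡ c) G → length G ≤ n) →
    length ys ≤ length L * n
  pigeonhole []      []      _        _ = z≤n
  pigeonhole []      (_ ∷ _) (() ∷ _) _
  pigeonhole {n} (c ∷ L) ys fys∈ fibre = begin
    length ys                                            ≡⟨ length-filter-∁ P? ys ⟩
    length (filter P? ys) + length (filter (∁? P?) ys)  ≤⟨ +-mono-≤ fibre-c rest ⟩
    n + length L * n                                     ∎
    where
    open ≤-Reasoning
    P? = λ y → f y ≟ c
    fibre-c = fibre (here refl) (filter-⊆ P? ys) (all-filter P? ys)
    rest = pigeonhole L (filter (∁? P?) ys)
      (All.zipWith (λ (fy≢c , fy∈) → Any.tail fy≢c fy∈)
                   (all-filter (∁? P?) ys , filter⁺ (∁? P?) fys∈))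
      (λ c∈L G⊆ → fibre (there c∈L) (⊆-trans G⊆ (filter-⊆ (∁? P?) ys)))

module _ {V C : Set} (_≟_ : DecidableEquality C) (col : V → V → C)
  (triangle-free : ∀ {x y z} κ → x ≢ y → x ≢ z → y ≢ z →
                   col x y ≡ κ → col x z ≡ κ → col y z ≡ κ → ⊥) where

  fibre-avoids : ∀ {x c G} → All (x ≢_) G → All (λ y → col x y ≡ c) G → Unique G →
    AllPairs (λ y z → col y z ≢ c) G
  fibre-avoids []          []            []             = []
  fibre-avoids (x≢y ∷ x≢G) (xy≡c ∷ xG≡c) (y≢G ∷ unique) =
    All.tabulate (λ z∈G → triangle-free _ x≢y (All.lookup x≢G z∈G) (All.lookup y≢G z∈G)
                                          xy≡c (All.lookup xG≡c z∈G)) ∷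
    fibre-avoids x≢G xG≡c unique

  triangle-free-length : ∀ t (L : List C) {xs : List V} → length L ≤ t → Unique xs →
    AllPairs (λ x y → col x y ∈ L) xs → length xs ≤ ramseyBound t
  triangle-free-length _       _       {[]}          _ _ _ = z≤n
  triangle-free-length zero    []      {_ ∷ []}      _ _ _ = ≤-refl
  triangle-free-length zero    []      {_ ∷ _ ∷ _}   _ _ ((() ∷ _) ∷ _)
  triangle-free-length (suc t) L {x ∷ rest} |L|≤1+t (x∉rest ∷ unique) (x-edges ∷ palette) =
    s≤s (begin
      length rest                  ≤⟨ pigeonhole _≟_ (col x) L rest x-edges fibre ⟩
      length L * ramseyBound t     ≤⟨ *-monoˡ-≤ (ramseyBound t) |L|≤1+t ⟩
      suc t * ramseyBound t        ∎)
    where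
    open ≤-Reasoning
    fibre : ∀ {c G} → c ∈ L → G ⊆ rest → All (λ y → col x y ≡ c) G →
      length G ≤ ramseyBound t
    fibre {c} c∈L G⊆rest xG≡c =
      triangle-free-length t (filter ≢c? L) shorter unique-G
        (AllPairs.zipWith (λ (∈L , ≢c) → ∈-filter⁺ ≢c? ∈L ≢c)
          (AllPairs-resp-⊆ G⊆rest palette ,
           fibre-avoids (All-resp-⊆ G⊆rest x∉rest) xG≡c unique-G))
      where
      ≢c? = λ c′ → ¬? (c′ ≟ c)
      unique-G = AllPairs-resp-⊆ G⊆rest unique
      shorter : length (filter ≢c? L) ≤ t
      shorter = ≤-pred (≤-trans
        (filter-notAll ≢c? L (Any.map (λ { refl c≢c → c≢c refl }) c∈L)) |L|≤1+t)

allVectors : ∀ m → List (F2 m)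
allVectors zero    = [] ∷ []
allVectors (suc m) =
  List.map (true ∷_) (allVectors m) List.++ List.map (false ∷_) (allVectors m)

length-allVectors : ∀ m → length (allVectors m) ≡ 2 ^ m
length-allVectors zero    = refl
length-allVectors (suc m) = begin
  length (List.map (true ∷_) vs List.++ List.map (false ∷_) vs)
    ≡⟨ length-++ (List.map (true ∷_) vs) ⟩
  length (List.map (true ∷_) vs) + length (List.map (false ∷_) vs)
    ≡⟨ cong₂ _+_ (length-map (true ∷_) vs) (length-map (false ∷_) vs) ⟩
  length vs + length vs
    ≡⟨ cong (λ k → k + k) (length-allVectors m) ⟩
  2 ^ m + 2 ^ m
    ≡⟨ cong (2 ^ m +_) (+-identityʳ (2 ^ m)) ⟨
  2 ^ suc m ∎
  where
  open ≡-Reasoning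
  vs = allVectors m

allVectors-unique : ∀ m → Unique (allVectors m)
allVectors-unique zero    = [] ∷ []
allVectors-unique (suc m) =
  Unique.++⁺ (Unique.map⁺ ∷-injectiveʳ (allVectors-unique m))
             (Unique.map⁺ ∷-injectiveʳ (allVectors-unique m)) disjoint
  where
  disjoint : Disjoint (List.map (true ∷_) (allVectors m)) (List.map (false ∷_) (allVectors m))
  disjoint (v∈₁ , v∈₂) with ∈-map⁻ _ v∈₁ | ∈-map⁻ _ v∈₂
  ... | _ , _ , refl | _ , _ , ()

-- Edges {x, y} of the complete graph on F₂^m coloured by c (x ⊕ y):
-- a monochromatic triangle is a monochromatic line.
ramseyBound<2^m⇒¬colorable : ∀ {m k} → ramseyBound k < 2 ^ m → ¬ Colorable m k
ramseyBound<2^m⇒¬colorable {m} {k} bound<2^m (c , c-proper) = <⇒≱ bound<2^m (begin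
  2 ^ m                  ≡⟨ length-allVectors m ⟨
  length (allVectors m)  ≤⟨ triangle-free-length Finₚ._≟_ (λ x y → c (x ⊕ y)) no-triangle
                              k (allFin k) (≤-reflexive (length-tabulate (λ i → i)))
                              (allVectors-unique m)
                              (AllPairs.map (λ _ → ∈-allFin _) (allVectors-unique m)) ⟩
  ramseyBound k          ∎)
  where
  open ≤-Reasoning
  no-triangle : ∀ {x y z} κ → x ≢ y → x ≢ z → y ≢ z →
    c (x ⊕ y) ≡ κ → c (x ⊕ z) ≡ κ → c (y ⊕ z) ≡ κ → ⊥
  no-triangle {x} {y} {z} κ x≢y x≢z y≢z cxy cxz cyz =
    properColoring⇒proper c-proper κ (x≢y ∘ ⊕≡0⇒≡) (x≢z ∘ ⊕≡0⇒≡)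
      (y≢z ∘ ⊕≡0⇒≡ ∘ trans (sym ([x⊕y]⊕[x⊕z]≡y⊕z x y z)))
      cxy cxz (trans (cong c ([x⊕y]⊕[x⊕z]≡y⊕z x y z)) cyz)

n<2^n : ∀ n → n < 2 ^ n
n<2^n zero    = s≤s z≤n
n<2^n (suc n) = begin-strict
  suc n           <⟨ s≤s (n<2^n n) ⟩
  suc (2 ^ n)     ≤⟨ +-monoˡ-≤ (2 ^ n) (m^n>0 2 n) ⟩
  2 ^ n + 2 ^ n   ≡⟨ cong (2 ^ n +_) (+-identityʳ (2 ^ n)) ⟨
  2 ^ suc n       ∎
  where open ≤-Reasoning

ramseyBound[1+s]<2^[2+s*[1+s]] : ∀ s → ramseyBound (suc s) < 2 ^ (2 + s * suc s)
ramseyBound[1+s]<2^[2+s*[1+s]] zero    = s≤s (s≤s (s≤s z≤n))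
ramseyBound[1+s]<2^[2+s*[1+s]] (suc s) = begin-strict
  suc ((2 + s) * M)            <⟨ s≤s (s≤s (m≤n+m ((2 + s) * M) s)) ⟩
  (2 + s) + (2 + s) * M        ≡⟨ *-suc (2 + s) M ⟨
  (2 + s) * suc M              ≤⟨ *-monoʳ-≤ (2 + s) (ramseyBound[1+s]<2^[2+s*[1+s]] s) ⟩
  (2 + s) * X                  ≤⟨ *-monoˡ-≤ X 2+s≤ ⟩
  2 ^ (2 + (s + s)) * X        ≡⟨ ^-distribˡ-+-* 2 (2 + (s + s)) (2 + s * suc s) ⟨
  2 ^ ((2 + (s + s)) + (2 + s * suc s)) ≡⟨ cong (2 ^_) (exponent s) ⟩
  2 ^ (2 + suc s * suc (suc s)) ∎
  where
  open ≤-Reasoning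
  M = ramseyBound (suc s)
  X = 2 ^ (2 + s * suc s)
  2+s≤ : 2 + s ≤ 2 ^ (2 + (s + s))
  2+s≤ = ≤-trans (<⇒≤ (n<2^n (2 + s))) (^-monoʳ-≤ 2 (+-monoʳ-≤ 2 (m≤n+m s s)))
  exponent : ∀ s → (2 + (s + s)) + (2 + s * suc s) ≡ 2 + suc s * suc (suc s)
  exponent = solve-∀

colorable⇒e≤s*[1+s] : ∀ {e s} → Colorable (suc e) (suc s) → e ≤ s * suc s
colorable⇒e≤s*[1+s] {e} {s} col = ≮⇒≥ λ s*[1+s]<e →
  ramseyBound<2^m⇒¬colorable
    (<-≤-trans (ramseyBound[1+s]<2^[2+s*[1+s]] s) (^-monoʳ-≤ 2 (s≤s s*[1+s]<e))) col

residue-colorable : ∀ {e s} .{{_ : NonZero e}} → Colorable (suc e) (suc s) →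
  ∀ r → r < e → Colorable (suc r) (s * suc r / e + s)
residue-colorable {e} {s} col r r<e with suc r ≤? s
... | yes 1+r≤s = colorable-monoʳ (≤-trans 1+r≤s (m≤n+m s _)) (colorable-diagonal r)
... | no  1+r≰s =
  colorable-monoʳ (+-monoˡ-≤ s 1≤s[1+r]/e) (colorable-restrict (s≤s (<⇒≤ r<e)) col)
  where
  1≤s[1+r]/e : 1 ≤ s * suc r / e
  1≤s[1+r]/e = ≤-trans (≤-reflexive (sym (n/n≡1 e)))
    (/-monoˡ-≤ e (≤-trans (colorable⇒e≤s*[1+s] col) (*-monoʳ-≤ s (≰⇒> 1+r≰s))))

residue-colorable-diagonal : ∀ {e s} .{{_ : NonZero e}} → e ≤ suc s →
  ∀ r → r < e → Colorable (suc r) (s * suc r / e + 1)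
residue-colorable-diagonal {e} {s} e≤1+s r r<e =
  colorable-monoʳ (subst (_≤ s * suc r / e + 1) (+-comm r 1) (+-monoˡ-≤ 1 r≤s[1+r]/e))
    (colorable-diagonal r)
  where
  open ≤-Reasoning
  r≤s : r ≤ s
  r≤s = ≤-pred (≤-trans r<e e≤1+s)
  r≤s[1+r]/e : r ≤ s * suc r / e
  r≤s[1+r]/e = begin
    r                 ≡⟨ m*n/n≡m r e ⟨
    r * e / e         ≤⟨ /-monoˡ-≤ e (*-monoʳ-≤ r e≤1+s) ⟩
    r * suc s / e     ≡⟨ cong (_/ e) (*-suc r s) ⟩
    (r + r * s) / e   ≤⟨ /-monoˡ-≤ e (+-mono-≤ r≤s (≤-reflexive (*-comm r s))) ⟩
    (s + s * r) / e   ≡⟨ cong (_/ e) (*-suc s r) ⟨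
    s * suc r / e     ∎

χ₂-linear : (d : ℕ) → 2 ≤ d → (χd : ℕ) → IsChi2 d χd →
  Σ ℕ (λ C → (1 ≤ C) × (C ≤ χd ∸ 1) ×
    ((n : ℕ) → d ≤ n → (χn : ℕ) → IsChi2 n χn →
      χn ≤ floorDiv ((χd ∸ 1) * n) (d ∸ 1) + C))
χ₂-linear (suc zero) (s≤s ()) _ _
χ₂-linear (suc (suc _)) _ zero ((c , _) , _) with () ← c (zeroV _)
χ₂-linear (suc (suc _)) _ (suc zero) (col , _) with () ← colorable⇒e≤s*[1+s] col
χ₂-linear (suc (suc _)) _ (suc s@(suc _)) (col , _) =
  s , s≤s z≤n , ≤-refl ,
  λ { zero () ;
      (suc n) _ _ (_ , minimal) → minimal _ (colorable-linear col (residue-colorable col) n) }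

χ₂-linear-4 : (χ4 : ℕ) → IsChi2 4 χ4 →
  (n : ℕ) → 4 ≤ n → (χn : ℕ) → IsChi2 n χn → χn ≤ floorDiv ((χ4 ∸ 1) * n) 3 + 1
χ₂-linear-4 zero ((c , _) , _) with () ← c (zeroV _)
χ₂-linear-4 (suc zero) (col , _) with () ← colorable⇒e≤s*[1+s] col
χ₂-linear-4 (suc (suc zero)) (col , _) with s≤s (s≤s ()) ← colorable⇒e≤s*[1+s] col
χ₂-linear-4 (suc s@(suc (suc _))) (col , _) (suc n) _ _ (_ , minimal) =
  minimal _ (colorable-linear col (residue-colorable-diagonal {s = s} 3≤1+s) n)
  where
  3≤1+s : 3 ≤ suc s
  3≤1+s = s≤s (s≤s (s≤s z≤n))

proposition6p1 :
    ((d : ℕ) → 2 ≤ d → (χd : ℕ) → IsChi2 d χd →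
      Σ ℕ (λ C → (1 ≤ C) × (C ≤ χd ∸ 1) ×
        ((n : ℕ) → d ≤ n → (χn : ℕ) → IsChi2 n χn →
          χn ≤ floorDiv ((χd ∸ 1) * n) (d ∸ 1) + C)))
    ×
    ((χ4 : ℕ) → IsChi2 4 χ4 →
      (n : ℕ) → 4 ≤ n → (χn : ℕ) → IsChi2 n χn →
        χn ≤ floorDiv ((χ4 ∸ 1) * n) 3 + 1)
proposition6p1 = χ₂-linear , χ₂-linear-4
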